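{- Let $R_1,R_2,S_1,S_2$ be finite posets. If $R_1\sqsubseteq_\Gamma S_1$ and $R_2\sqsubseteq_\Gamma S_2$ with respect to $\mathfrak{P}$, then $R_1\oplus R_2\sqsubseteq_\Gamma S_1\oplus S_2$ with respect to $\mathfrak{P}$.
   Context: A poset is a finite reflexive, antisymmetric, transitive digraph $(V,A)$; $\mathfrak{P}$ is the class of finite posets. The ordinal sum $P\oplus Q$ is the poset on the disjoint union $V(P)\cup V(Q)$ with arcs $A(P)\cup A(Q)\cup(V(P)\times V(Q))$. Homomorphisms $\xi:G\to H$ are maps with $\xi(v)\xi(w)\in A(H)$ for $vw\in A(G)$, $\mathcal{H}(G,H)$ their set. $v,w$ adjacent if $vw$ or $wv$ is an arc; for $X\subseteq V(G)$, $v\in X$, $\gamma_X(v)$ = set of $w\in X$ equal to $v$ or joined to $v$ by a sequence in $X$ of consecutively adjacent vertices; $\Gamma_\xi(v)=\gamma_{\xi^{ -1}(\xi(v))}(v)$. $R\sqsubseteq_\Gamma S$ w.r.t. $\mathfrak{P}$ means: for a representative system $\mathfrak{P}_r$ of $\mathfrak{P}$ up to isomorphism there exist injective maps $\rho_G:\mathcal{H}(G,R)\to\mathcal{H}(G,S)$, $G\in\mathfrak{P}_r$, with $\Gamma_{\rho_G(\xi)}(v)=\Gamma_\xi(v)$ for all $G,\xi,v$. -}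

module Defs where

open import Data.Nat using (ℕ; _+_)
open import Data.Fin using (Fin; splitAt)
open import Data.Sum using (_⊎_; inj₁; inj₂)
open import Data.Product using (_×_; Σ)
open import Data.Unit using (⊤)
open import Data.Empty using (⊥)
open import Relation.Binary.PropositionalEquality using (_≡_)
open import Function.Bundles using (_⇔_)

record Digraph : Set₁ where
  field
    size : ℕ
    arc  : Fin size → Fin size → Set
open Digraph public

record IsPoset (G : Digraph) : Set where
  field
    reflexive     : ∀ v → arc G v v
    antisymmetric : ∀ v w → arc G v w → arc G w v → v ≡ w
    transitive    : ∀ u v w → arc G u v → arc G v w → arc G u w

ordArc : (P Q : Digraph) → Fin (size P) ⊎ Fin (size Q) → Fin (size P) ⊎ Fin (size Q) → Set
ordArc P Q (inj₁ a) (inj₁ b) = arc P a b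
ordArc P Q (inj₁ a) (inj₂ b) = ⊤
ordArc P Q (inj₂ a) (inj₁ b) = ⊥
ordArc P Q (inj₂ a) (inj₂ b) = arc Q a b

_⊕_ : Digraph → Digraph → Digraph
P ⊕ Q = record
  { size = size P + size Q
  ; arc  = λ v w → ordArc P Q (splitAt (size P) v) (splitAt (size P) w) }

record Hom (G H : Digraph) : Set where
  field
    map      : Fin (size G) → Fin (size H)
    preserve : ∀ v w → arc G v w → arc H (map v) (map w)
open Hom public

_≈ₕ_ : ∀ {G H} → Hom G H → Hom G H → Set
ξ ≈ₕ ζ = ∀ v → map ξ v ≡ map ζ v

Adjacent : (G : Digraph) → Fin (size G) → Fin (size G) → Set
Adjacent G v w = arc G v w ⊎ arc G w v

-- InΓ ξ v w  :  w ∈ Γ_ξ(v) = γ_{ξ⁻¹(ξ(v))}(v), i.e. w = v or w is joined to v by a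
-- sequence of consecutively adjacent vertices all lying in the fibre ξ⁻¹(ξ(v)).
data InΓ {G H : Digraph} (ξ : Hom G H) (v : Fin (size G)) : Fin (size G) → Set where
  here : InΓ ξ v v
  step : ∀ {w u} → InΓ ξ v w → Adjacent G w u → map ξ u ≡ map ξ v → InΓ ξ v u

SameΓ : ∀ {G H H'} → Hom G H → Hom G H' → Fin (size G) → Set
SameΓ ξ ζ v = ∀ w → InΓ ξ v w ⇔ InΓ ζ v w

-- R ⊑_Γ S with respect to the class 𝔓 of finite posets: for every finite poset G
-- there is an injective map ρ_G : 𝓗(G,R) → 𝓗(G,S) (well defined on homomorphisms
-- as maps) preserving Γ at every vertex.
_⊑Γ_ : Digraph → Digraph → Set₁
R ⊑Γ S = (G : Digraph) → IsPoset G →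
  Σ (Hom G R → Hom G S) λ ρ →
      (∀ ξ ζ → ξ ≈ₕ ζ → ρ ξ ≈ₕ ρ ζ)
    × (∀ ξ ζ → ρ ξ ≈ₕ ρ ζ → ξ ≈ₕ ζ)
    × (∀ ξ v → SameΓ (ρ ξ) ξ v)

-- A homomorphism ξ : G → R₁ ⊕ R₂ amounts to a down-set p of G (the preimage of
-- R₁) together with homomorphisms G ↾ p → R₁ and G ↾ ∁ p → R₂.  Map these two
-- pieces by the given embeddings for the induced subposets G ↾ p and G ↾ ∁ p
-- and glue the results back along the same p.  Each fibre of ξ lies on one side
-- of the partition, so Γ_ξ(v) is computed inside G ↾ p or G ↾ ∁ p, where the
-- embeddings preserve it; and the glued map determines p, whence injectivity.

module Submission where

open import Defs
open import Data.Bool.Base using (not)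
open import Data.Empty using (⊥-elim)
open import Data.Fin.Base using (Fin; zero; suc; splitAt; join; _↑ˡ_; _↑ʳ_)
open import Data.Fin.Properties using (splitAt-join; join-splitAt; ↑ˡ-injective; ↑ʳ-injective)
open import Data.Fin.Subset using (Subset; Side; inside; outside; ∁; ∣_∣)
open import Data.Nat.Base using (ℕ)
open import Data.Product.Base using (∃; _×_; _,_; proj₁; proj₂)
open import Data.Sum.Base as ⊎ using (_⊎_; inj₁; inj₂; [_,_]; [_,_]′)
open import Data.Sum.Properties
  using (inj₁-injective; inj₂-injective) renaming (map-cong to ⊎-map-cong)
open import Data.Unit.Base using (tt)
open import Data.Vec.Base using (_∷_; lookup; tabulate)
open import Data.Vec.Properties using (lookup∘tabulate; tabulate∘lookup; tabulate-cong; lookup-map)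
open import Function.Base using (_∘_; id)
open import Function.Bundles using (mk⇔; Equivalence)
import Function.Properties.Equivalence as ⇔
open import Level using (Level)
open import Relation.Binary.PropositionalEquality.Core
open import Relation.Binary.PropositionalEquality.Properties using (module ≡-Reasoning)

private
  variable
    ℓ : Level
    n : ℕ
    A B C D : Set
    G H H′ P Q P′ Q′ : Digraph

side : A ⊎ B → Side
side (inj₁ _) = inside
side (inj₂ _) = outside

side-map : (f : A → C) (g : B → D) (y : A ⊎ B) → side (⊎.map f g y) ≡ side y
side-map f g (inj₁ _) = refl
side-map f g (inj₂ _) = refl

side≡inside : (y : A ⊎ B) → side y ≡ inside → ∃ λ a → y ≡ inj₁ a
side≡inside (inj₁ a) _ = a , refl

side≡outside : (y : A ⊎ B) → side y ≡ outside → ∃ λ b → y ≡ inj₂ b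
side≡outside (inj₂ b) _ = b , refl

inside≢outside : inside ≢ outside
inside≢outside ()

decompose : (p : Subset n) → Fin n → Fin ∣ p ∣ ⊎ Fin ∣ ∁ p ∣
decompose (inside  ∷ p) zero    = inj₁ zero
decompose (inside  ∷ p) (suc v) = ⊎.map₁ suc (decompose p v)
decompose (outside ∷ p) zero    = inj₂ zero
decompose (outside ∷ p) (suc v) = ⊎.map₂ suc (decompose p v)

members : (p : Subset n) → Fin ∣ p ∣ → Fin n
members (inside  ∷ p) zero    = zero
members (inside  ∷ p) (suc i) = suc (members p i)
members (outside ∷ p) i       = suc (members p i)

recompose : (p : Subset n) → Fin ∣ p ∣ ⊎ Fin ∣ ∁ p ∣ → Fin n
recompose p = [ members p , members (∁ p) ]′

decompose-recompose : (p : Subset n) (y : Fin ∣ p ∣ ⊎ Fin ∣ ∁ p ∣) →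
                      decompose p (recompose p y) ≡ y
decompose-recompose (inside  ∷ p) (inj₁ zero)    = refl
decompose-recompose (inside  ∷ p) (inj₁ (suc i)) = cong (⊎.map₁ suc) (decompose-recompose p (inj₁ i))
decompose-recompose (inside  ∷ p) (inj₂ j)       = cong (⊎.map₁ suc) (decompose-recompose p (inj₂ j))
decompose-recompose (outside ∷ p) (inj₁ i)       = cong (⊎.map₂ suc) (decompose-recompose p (inj₁ i))
decompose-recompose (outside ∷ p) (inj₂ zero)    = refl
decompose-recompose (outside ∷ p) (inj₂ (suc j)) = cong (⊎.map₂ suc) (decompose-recompose p (inj₂ j))

recompose-decompose : (p : Subset n) (v : Fin n) → recompose p (decompose p v) ≡ v
recompose-decompose (inside ∷ p) zero = refl
recompose-decompose (inside ∷ p) (suc v) with decompose p v | recompose-decompose p v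
... | inj₁ _ | eq = cong suc eq
... | inj₂ _ | eq = cong suc eq
recompose-decompose (outside ∷ p) zero = refl
recompose-decompose (outside ∷ p) (suc v) with decompose p v | recompose-decompose p v
... | inj₁ _ | eq = cong suc eq
... | inj₂ _ | eq = cong suc eq

side-decompose : (p : Subset n) (v : Fin n) → side (decompose p v) ≡ lookup p v
side-decompose (inside  ∷ p) zero    = refl
side-decompose (inside  ∷ p) (suc v) = trans (side-map suc id (decompose p v)) (side-decompose p v)
side-decompose (outside ∷ p) zero    = refl
side-decompose (outside ∷ p) (suc v) = trans (side-map id suc (decompose p v)) (side-decompose p v)

members-injective : (p : Subset n) {i j : Fin ∣ p ∣} → members p i ≡ members p j → i ≡ j
members-injective p {i} {j} eq = inj₁-injective (begin
  inj₁ i                              ≡⟨ decompose-recompose p (inj₁ i) ⟨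
  decompose p (members p i)           ≡⟨ cong (decompose p) eq ⟩
  decompose p (members p j)           ≡⟨ decompose-recompose p (inj₁ j) ⟩
  inj₁ j                              ∎)
  where open ≡-Reasoning

lookup-members : (p : Subset n) (i : Fin ∣ p ∣) → lookup p (members p i) ≡ inside
lookup-members p i =
  trans (sym (side-decompose p (members p i))) (cong side (decompose-recompose p (inj₁ i)))

lookup-members∁ : (p : Subset n) (j : Fin ∣ ∁ p ∣) → lookup p (members (∁ p) j) ≡ outside
lookup-members∁ p j =
  trans (sym (side-decompose p (members (∁ p) j))) (cong side (decompose-recompose p (inj₂ j)))

inside⇒members : (p : Subset n) {v : Fin n} → lookup p v ≡ inside → ∃ λ i → members p i ≡ v
inside⇒members p {v} v∈p with side≡inside (decompose p v) (trans (side-decompose p v) v∈p)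
... | i , eq = i , trans (cong (recompose p) (sym eq)) (recompose-decompose p v)

members-elim : (p : Subset n) (R : Fin n → Set ℓ) →
               (∀ i → R (members p i)) → (∀ j → R (members (∁ p) j)) → ∀ v → R v
members-elim p R r₁ r₂ v =
  subst R (recompose-decompose p v) ([_,_] {C = R ∘ recompose p} r₁ r₂ (decompose p v))

_↾_ : (G : Digraph) → Subset (size G) → Digraph
G ↾ p = record { size = ∣ p ∣ ; arc = λ i j → arc G (members p i) (members p j) }

↾-isPoset : IsPoset G → (p : Subset (size G)) → IsPoset (G ↾ p)
↾-isPoset isPoset p = record
  { reflexive     = λ i → reflexive (members p i)
  ; antisymmetric = λ i j ij ji → members-injective p (antisymmetric _ _ ij ji)
  ; transitive    = λ i j k → transitive _ _ _
  }
  where open IsPoset isPoset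

≈ₕ⇒SameΓ : {ξ ζ : Hom G H} → ξ ≈ₕ ζ → ∀ v → SameΓ ξ ζ v
≈ₕ⇒SameΓ {G} {H} ξ≈ζ v w = mk⇔ (transport ξ≈ζ) (transport (λ u → sym (ξ≈ζ u)))
  where
    transport : ∀ {ξ ζ : Hom G H} {w} → ξ ≈ₕ ζ → InΓ ξ v w → InΓ ζ v w
    transport ξ≈ζ here = here
    transport ξ≈ζ (step {u = u} x adj eq) =
      step (transport ξ≈ζ x) adj (trans (sym (ξ≈ζ u)) (trans eq (ξ≈ζ v)))

-- Γ_ψ(v) never leaves the fibre of v, so once the fibres of ψ meeting p lie
-- inside p, Γ can be computed in G ↾ p.
record Restricts (p : Subset (size G)) (ψ : Hom G H) (ψ′ : Hom (G ↾ p) H′) : Set where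
  field
    embed           : Fin (size H′) → Fin (size H)
    embed-injective : ∀ {x y} → embed x ≡ embed y → x ≡ y
    commutes        : ∀ i → map ψ (members p i) ≡ embed (map ψ′ i)
    preimage-inside : ∀ {u x} → map ψ u ≡ embed x → lookup p u ≡ inside

module _ {p : Subset (size G)} {ψ : Hom G H} {ψ′ : Hom (G ↾ p) H′}
         (res : Restricts p ψ ψ′) where
  open Restricts res

  InΓ-restrict : ∀ {i w} → InΓ ψ (members p i) w → ∃ λ j → members p j ≡ w × InΓ ψ′ i j
  InΓ-restrict {i} here = i , refl , here
  InΓ-restrict {i} (step x adj eq) with InΓ-restrict x
  ... | j , refl , x′ with inside⇒members p (preimage-inside (trans eq (commutes i)))
  ...   | k , refl = k , refl , step x′ adj
                       (embed-injective (trans (sym (commutes k)) (trans eq (commutes i))))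

  InΓ-extend : ∀ {i j} → InΓ ψ′ i j → InΓ ψ (members p i) (members p j)
  InΓ-extend here = here
  InΓ-extend {i} (step {u = k} x adj eq) =
    step (InΓ-extend x) adj (trans (commutes k) (trans (cong embed eq) (sym (commutes i))))

InΓ-transfer : {p : Subset (size G)} {ψ : Hom G H} {ψ′ : Hom (G ↾ p) H′}
               {φ : Hom G P} {φ′ : Hom (G ↾ p) Q} →
               Restricts p ψ ψ′ → Restricts p φ φ′ → ∀ {i w} →
               (∀ {j} → InΓ ψ′ i j → InΓ φ′ i j) →
               InΓ ψ (members p i) w → InΓ φ (members p i) w
InΓ-transfer resψ resφ ψ′⊆φ′ x with InΓ-restrict resψ x
... | j , refl , x′ = InΓ-extend resφ (ψ′⊆φ′ x′)

SameΓ-lift : {p : Subset (size G)} {ψ : Hom G H} {ψ′ : Hom (G ↾ p) H′}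
             {φ : Hom G P} {φ′ : Hom (G ↾ p) Q} →
             Restricts p ψ ψ′ → Restricts p φ φ′ →
             ∀ i → SameΓ ψ′ φ′ i → SameΓ ψ φ (members p i)
SameΓ-lift resψ resφ i same w =
  mk⇔ (InΓ-transfer resψ resφ (Equivalence.to (same _)))
      (InΓ-transfer resφ resψ (Equivalence.from (same _)))

record IsDownSet (G : Digraph) (p : Subset (size G)) : Set where
  field
    downward-closed : ∀ {v w} → arc G v w → lookup p w ≡ inside → lookup p v ≡ inside
open IsDownSet

glue : {p : Subset (size G)} → IsDownSet G p →
       Hom (G ↾ p) P → Hom (G ↾ ∁ p) Q → Hom G (P ⊕ Q)
glue {G = G} {P = P} {Q = Q} {p = p} down σ₁ σ₂ = record
  { map      = join (size P) (size Q) ∘ glued ∘ decompose p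
  ; preserve = λ v w vw →
      subst₂ (ordArc P Q) (sym (splitAt-join (size P) (size Q) (glued (decompose p v))))
                          (sym (splitAt-join (size P) (size Q) (glued (decompose p w))))
        (preserve-glued (decompose p v) (decompose p w)
          (subst₂ (arc G) (sym (recompose-decompose p v)) (sym (recompose-decompose p w)) vw))
  }
  where
    glued : Fin ∣ p ∣ ⊎ Fin ∣ ∁ p ∣ → Fin (size P) ⊎ Fin (size Q)
    glued = ⊎.map (map σ₁) (map σ₂)

    preserve-glued : ∀ y z → arc G (recompose p y) (recompose p z) → ordArc P Q (glued y) (glued z)
    preserve-glued (inj₁ i) (inj₁ j) ij = preserve σ₁ i j ij
    preserve-glued (inj₁ i) (inj₂ j) ij = tt
    preserve-glued (inj₂ i) (inj₁ j) ij = ⊥-elim (inside≢outside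
      (trans (sym (downward-closed down ij (lookup-members p j))) (lookup-members∁ p i)))
    preserve-glued (inj₂ i) (inj₂ j) ij = preserve σ₂ i j ij

module _ {p : Subset (size G)} (d : IsDownSet G p)
         (σ₁ : Hom (G ↾ p) P) (σ₂ : Hom (G ↾ ∁ p) Q) where

  glue-members : ∀ i → map (glue d σ₁ σ₂) (members p i) ≡ map σ₁ i ↑ˡ size Q
  glue-members i = cong (join (size P) (size Q) ∘ ⊎.map (map σ₁) (map σ₂))
                        (decompose-recompose p (inj₁ i))

  glue-members∁ : ∀ j → map (glue d σ₁ σ₂) (members (∁ p) j) ≡ size P ↑ʳ map σ₂ j
  glue-members∁ j = cong (join (size P) (size Q) ∘ ⊎.map (map σ₁) (map σ₂))
                         (decompose-recompose p (inj₂ j))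

  glue-side : ∀ v → side (splitAt (size P) (map (glue d σ₁ σ₂) v)) ≡ lookup p v
  glue-side v = begin
    side (splitAt (size P) (join (size P) (size Q) (glued (decompose p v))))
      ≡⟨ cong side (splitAt-join (size P) (size Q) (glued (decompose p v))) ⟩
    side (glued (decompose p v))  ≡⟨ side-map (map σ₁) (map σ₂) (decompose p v) ⟩
    side (decompose p v)          ≡⟨ side-decompose p v ⟩
    lookup p v                    ∎
    where
      open ≡-Reasoning
      glued = ⊎.map (map σ₁) (map σ₂)

  glue-preimage : ∀ {u y} → map (glue d σ₁ σ₂) u ≡ join (size P) (size Q) y →
                  lookup p u ≡ side y
  glue-preimage {u} {y} eq = begin
    lookup p u                                          ≡⟨ glue-side u ⟨
    side (splitAt (size P) (map (glue d σ₁ σ₂) u))      ≡⟨ cong (side ∘ splitAt (size P)) eq ⟩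
    side (splitAt (size P) (join (size P) (size Q) y))  ≡⟨ cong side (splitAt-join _ (size Q) y) ⟩
    side y                                              ∎
    where open ≡-Reasoning

  glue-restricts : Restricts p (glue d σ₁ σ₂) σ₁
  glue-restricts = record
    { embed           = _↑ˡ size Q
    ; embed-injective = ↑ˡ-injective (size Q) _ _
    ; commutes        = glue-members
    ; preimage-inside = glue-preimage
    }

  glue-restricts∁ : Restricts (∁ p) (glue d σ₁ σ₂) σ₂
  glue-restricts∁ = record
    { embed           = size P ↑ʳ_
    ; embed-injective = ↑ʳ-injective (size P) _ _
    ; commutes        = glue-members∁
    ; preimage-inside = λ {u} eq → trans (lookup-map u not p) (cong not (glue-preimage eq))
    }

module _ {p : Subset (size G)}
         (d : IsDownSet G p) (σ₁ : Hom (G ↾ p) P) (σ₂ : Hom (G ↾ ∁ p) Q)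
         (d′ : IsDownSet G p) (τ₁ : Hom (G ↾ p) P) (τ₂ : Hom (G ↾ ∁ p) Q) where

  glue-cong : σ₁ ≈ₕ τ₁ → σ₂ ≈ₕ τ₂ → glue d σ₁ σ₂ ≈ₕ glue d′ τ₁ τ₂
  glue-cong σ₁≈τ₁ σ₂≈τ₂ v =
    cong (join (size P) (size Q)) (⊎-map-cong σ₁≈τ₁ σ₂≈τ₂ (decompose p v))

  glue-injective : glue d σ₁ σ₂ ≈ₕ glue d′ τ₁ τ₂ → σ₁ ≈ₕ τ₁ × σ₂ ≈ₕ τ₂
  glue-injective eq =
      (λ i → ↑ˡ-injective (size Q) _ _
               (trans (sym (glue-members d σ₁ σ₂ i))
                      (trans (eq (members p i)) (glue-members d′ τ₁ τ₂ i))))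
    , (λ j → ↑ʳ-injective (size P) _ _
               (trans (sym (glue-members∁ d σ₁ σ₂ j))
                      (trans (eq (members (∁ p) j)) (glue-members∁ d′ τ₁ τ₂ j))))

glue-SameΓ : {p : Subset (size G)} (d : IsDownSet G p) (d′ : IsDownSet G p)
             {σ₁ : Hom (G ↾ p) P} {σ₂ : Hom (G ↾ ∁ p) Q}
             {τ₁ : Hom (G ↾ p) P′} {τ₂ : Hom (G ↾ ∁ p) Q′} →
             (∀ i → SameΓ σ₁ τ₁ i) → (∀ j → SameΓ σ₂ τ₂ j) →
             ∀ v → SameΓ (glue d σ₁ σ₂) (glue d′ τ₁ τ₂) v
glue-SameΓ {p = p} d d′ {σ₁} {σ₂} {τ₁} {τ₂} same₁ same₂ =
  members-elim p (SameΓ (glue d σ₁ σ₂) (glue d′ τ₁ τ₂))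
    (λ i → SameΓ-lift (glue-restricts d σ₁ σ₂) (glue-restricts d′ τ₁ τ₂) i (same₁ i))
    (λ j → SameΓ-lift (glue-restricts∁ d σ₁ σ₂) (glue-restricts∁ d′ τ₁ τ₂) j (same₂ j))

module OrdinalSumHom (P Q : Digraph) {G : Digraph} where

  part : Hom G (P ⊕ Q) → Fin (size G) → Fin (size P) ⊎ Fin (size Q)
  part ξ v = splitAt (size P) (map ξ v)

  sides : Hom G (P ⊕ Q) → Subset (size G)
  sides ξ = tabulate (side ∘ part ξ)

  sides-cong : (ξ ζ : Hom G (P ⊕ Q)) → ξ ≈ₕ ζ → sides ξ ≡ sides ζ
  sides-cong ξ ζ ξ≈ζ = tabulate-cong (λ v → cong (side ∘ splitAt (size P)) (ξ≈ζ v))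

  sides-glue : {p : Subset (size G)} (d : IsDownSet G p)
               (σ₁ : Hom (G ↾ p) P) (σ₂ : Hom (G ↾ ∁ p) Q) →
               sides (glue d σ₁ σ₂) ≡ p
  sides-glue {p} d σ₁ σ₂ = trans (tabulate-cong (glue-side d σ₁ σ₂)) (tabulate∘lookup p)

  ordArc-side : ∀ y z → ordArc P Q y z → side z ≡ inside → side y ≡ inside
  ordArc-side (inj₁ _) _        _ _  = refl
  ordArc-side (inj₂ _) (inj₁ _) () _
  ordArc-side (inj₂ _) (inj₂ _) _  ()

  lookup-sides : (ξ : Hom G (P ⊕ Q)) → ∀ v → lookup (sides ξ) v ≡ side (part ξ v)
  lookup-sides ξ = lookup∘tabulate (side ∘ part ξ)

  sides-isDownSet : (ξ : Hom G (P ⊕ Q)) → IsDownSet G (sides ξ)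
  sides-isDownSet ξ = record { downward-closed = λ {v} {w} vw w∈ →
    trans (lookup-sides ξ v)
          (ordArc-side (part ξ v) (part ξ w) (preserve ξ v w vw)
                       (trans (sym (lookup-sides ξ w)) w∈)) }

  module _ (ξ : Hom G (P ⊕ Q)) {p : Subset (size G)} (sides≡p : sides ξ ≡ p) where

    private
      part-side : ∀ v → side (part ξ v) ≡ lookup p v
      part-side v = trans (sym (lookup-sides ξ v)) (cong (λ q → lookup q v) sides≡p)

      left : ∀ i → ∃ λ a → part ξ (members p i) ≡ inj₁ a
      left i = side≡inside _ (trans (part-side _) (lookup-members p i))

      right : ∀ j → ∃ λ b → part ξ (members (∁ p) j) ≡ inj₂ b
      right j = side≡outside _ (trans (part-side _) (lookup-members∁ p j))

    restrict : Hom (G ↾ p) P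
    restrict = record
      { map      = proj₁ ∘ left
      ; preserve = λ i j ij →
          subst₂ (ordArc P Q) (proj₂ (left i)) (proj₂ (left j)) (preserve ξ _ _ ij)
      }

    restrict∁ : Hom (G ↾ ∁ p) Q
    restrict∁ = record
      { map      = proj₁ ∘ right
      ; preserve = λ i j ij →
          subst₂ (ordArc P Q) (proj₂ (right i)) (proj₂ (right j)) (preserve ξ _ _ ij)
      }

    part-restrict : ∀ i → part ξ (members p i) ≡ inj₁ (map restrict i)
    part-restrict i = proj₂ (left i)

    part-restrict∁ : ∀ j → part ξ (members (∁ p) j) ≡ inj₂ (map restrict∁ j)
    part-restrict∁ j = proj₂ (right j)

    restrict-glue : (d : IsDownSet G p) → ξ ≈ₕ glue d restrict restrict∁
    restrict-glue d = members-elim p (λ v → map ξ v ≡ map (glue d restrict restrict∁) v)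
      (λ i → trans (sym (join-splitAt (size P) (size Q) (map ξ (members p i))))
                   (trans (cong (join (size P) (size Q)) (part-restrict i))
                          (sym (glue-members d restrict restrict∁ i))))
      (λ j → trans (sym (join-splitAt (size P) (size Q) (map ξ (members (∁ p) j))))
                   (trans (cong (join (size P) (size Q)) (part-restrict∁ j))
                          (sym (glue-members∁ d restrict restrict∁ j))))

  module _ (ξ ζ : Hom G (P ⊕ Q)) {p : Subset (size G)}
           (e : sides ξ ≡ p) (e′ : sides ζ ≡ p) (ξ≈ζ : ξ ≈ₕ ζ) where

    restrict-cong : restrict ξ e ≈ₕ restrict ζ e′
    restrict-cong i = inj₁-injective
      (trans (sym (part-restrict ξ e i))
             (trans (cong (splitAt (size P)) (ξ≈ζ _)) (part-restrict ζ e′ i)))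

    restrict∁-cong : restrict∁ ξ e ≈ₕ restrict∁ ζ e′
    restrict∁-cong j = inj₂-injective
      (trans (sym (part-restrict∁ ξ e j))
             (trans (cong (splitAt (size P)) (ξ≈ζ _)) (part-restrict∁ ζ e′ j)))

record Γ-Embedding (G R S : Digraph) : Set where
  field
    ρ           : Hom G R → Hom G S
    ρ-cong      : ∀ ξ ζ → ξ ≈ₕ ζ → ρ ξ ≈ₕ ρ ζ
    ρ-injective : ∀ ξ ζ → ρ ξ ≈ₕ ρ ζ → ξ ≈ₕ ζ
    ρ-SameΓ     : ∀ ξ v → SameΓ (ρ ξ) ξ v

⊑Γ⇒Γ-Embedding : {R S : Digraph} → R ⊑Γ S → IsPoset G → Γ-Embedding G R S
⊑Γ⇒Γ-Embedding R⊑S isPoset with R⊑S _ isPoset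
... | ρ , ρ-cong , ρ-injective , ρ-SameΓ = record
  { ρ = ρ ; ρ-cong = ρ-cong ; ρ-injective = ρ-injective ; ρ-SameΓ = ρ-SameΓ }

module _ {R₁ R₂ S₁ S₂ : Digraph}
         (emb₁ : ∀ p → Γ-Embedding (G ↾ p) R₁ S₁)
         (emb₂ : ∀ q → Γ-Embedding (G ↾ q) R₂ S₂) where

  open OrdinalSumHom R₁ R₂
  private
    module S = OrdinalSumHom S₁ S₂
    module E₁ p = Γ-Embedding (emb₁ p)
    module E₂ q = Γ-Embedding (emb₂ q)

    down : (ξ : Hom G (R₁ ⊕ R₂)) {p : Subset (size G)} → sides ξ ≡ p → IsDownSet G p
    down ξ e = subst (IsDownSet G) e (sides-isDownSet ξ)

    ρ₁ : (ξ : Hom G (R₁ ⊕ R₂)) {p : Subset (size G)} → sides ξ ≡ p → Hom (G ↾ p) S₁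
    ρ₁ ξ {p} e = E₁.ρ p (restrict ξ e)

    ρ₂ : (ξ : Hom G (R₁ ⊕ R₂)) {p : Subset (size G)} → sides ξ ≡ p → Hom (G ↾ ∁ p) S₂
    ρ₂ ξ {p} e = E₂.ρ (∁ p) (restrict∁ ξ e)

    ρ-at : (ξ : Hom G (R₁ ⊕ R₂)) {p : Subset (size G)} → sides ξ ≡ p → Hom G (S₁ ⊕ S₂)
    ρ-at ξ e = glue (down ξ e) (ρ₁ ξ e) (ρ₂ ξ e)

    ρ-at-cong : ∀ ξ ζ {p p′} (e : sides ξ ≡ p) (e′ : sides ζ ≡ p′) →
                ξ ≈ₕ ζ → ρ-at ξ e ≈ₕ ρ-at ζ e′
    ρ-at-cong ξ ζ e e′ ξ≈ζ with trans (sym e) (trans (sides-cong ξ ζ ξ≈ζ) e′)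
    ... | refl = glue-cong (down ξ e) (ρ₁ ξ e) (ρ₂ ξ e) (down ζ e′) (ρ₁ ζ e′) (ρ₂ ζ e′)
      (E₁.ρ-cong _ (restrict ξ e) (restrict ζ e′) (restrict-cong ξ ζ e e′ ξ≈ζ))
      (E₂.ρ-cong _ (restrict∁ ξ e) (restrict∁ ζ e′) (restrict∁-cong ξ ζ e e′ ξ≈ζ))

    sides-ρ-at : ∀ ξ {p} (e : sides ξ ≡ p) → S.sides (ρ-at ξ e) ≡ p
    sides-ρ-at ξ e = S.sides-glue (down ξ e) (ρ₁ ξ e) (ρ₂ ξ e)

    ρ-at-injective : ∀ ξ ζ {p p′} (e : sides ξ ≡ p) (e′ : sides ζ ≡ p′) →
                     ρ-at ξ e ≈ₕ ρ-at ζ e′ → ξ ≈ₕ ζ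
    ρ-at-injective ξ ζ {p} e e′ eq
      with trans (sym (sides-ρ-at ξ e))
                 (trans (S.sides-cong (ρ-at ξ e) (ρ-at ζ e′) eq) (sides-ρ-at ζ e′))
    ... | refl = λ v → begin
      map ξ v                ≡⟨ restrict-glue ξ e d v ⟩
      map (glue d ξ₁ ξ₂) v   ≡⟨ glue-cong d ξ₁ ξ₂ d ζ₁ ζ₂ ξ₁≈ζ₁ ξ₂≈ζ₂ v ⟩
      map (glue d ζ₁ ζ₂) v   ≡⟨ restrict-glue ζ e′ d v ⟨
      map ζ v                ∎
      where
        open ≡-Reasoning
        d : IsDownSet G p
        d = down ξ e
        ξ₁ ζ₁ : Hom (G ↾ p) R₁
        ξ₁ = restrict ξ e
        ζ₁ = restrict ζ e′
        ξ₂ ζ₂ : Hom (G ↾ ∁ p) R₂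
        ξ₂ = restrict∁ ξ e
        ζ₂ = restrict∁ ζ e′
        glued-ρ : ρ₁ ξ e ≈ₕ ρ₁ ζ e′ × ρ₂ ξ e ≈ₕ ρ₂ ζ e′
        glued-ρ = glue-injective (down ξ e) (ρ₁ ξ e) (ρ₂ ξ e) (down ζ e′) (ρ₁ ζ e′) (ρ₂ ζ e′) eq
        ξ₁≈ζ₁ : ξ₁ ≈ₕ ζ₁
        ξ₁≈ζ₁ = E₁.ρ-injective p ξ₁ ζ₁ (proj₁ glued-ρ)
        ξ₂≈ζ₂ : ξ₂ ≈ₕ ζ₂
        ξ₂≈ζ₂ = E₂.ρ-injective (∁ p) ξ₂ ζ₂ (proj₂ glued-ρ)

    ρ-at-SameΓ : ∀ ξ {p} (e : sides ξ ≡ p) v → SameΓ (ρ-at ξ e) ξ v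
    ρ-at-SameΓ ξ {p} e v w = ⇔.trans
      (glue-SameΓ (down ξ e) (down ξ e)
        (E₁.ρ-SameΓ p (restrict ξ e)) (E₂.ρ-SameΓ (∁ p) (restrict∁ ξ e)) v w)
      (≈ₕ⇒SameΓ (λ u → sym (restrict-glue ξ e (down ξ e) u)) v w)

  ⊕-Γ-Embedding : Γ-Embedding G (R₁ ⊕ R₂) (S₁ ⊕ S₂)
  ⊕-Γ-Embedding = record
    { ρ           = λ ξ → ρ-at ξ refl
    ; ρ-cong      = λ ξ ζ → ρ-at-cong ξ ζ refl refl
    ; ρ-injective = λ ξ ζ → ρ-at-injective ξ ζ refl refl
    ; ρ-SameΓ     = λ ξ → ρ-at-SameΓ ξ refl
    }

corollary8 : (R₁ R₂ S₁ S₂ : Digraph) →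
    IsPoset R₁ → IsPoset R₂ → IsPoset S₁ → IsPoset S₂ →
    R₁ ⊑Γ S₁ → R₂ ⊑Γ S₂ → (R₁ ⊕ R₂) ⊑Γ (S₁ ⊕ S₂)
corollary8 R₁ R₂ S₁ S₂ _ _ _ _ R₁⊑S₁ R₂⊑S₂ G isPoset =
  ρ , ρ-cong , ρ-injective , ρ-SameΓ
  where
    open Γ-Embedding (⊕-Γ-Embedding {G = G}
      (λ p → ⊑Γ⇒Γ-Embedding R₁⊑S₁ (↾-isPoset isPoset p))
      (λ q → ⊑Γ⇒Γ-Embedding R₂⊑S₂ (↾-isPoset isPoset q)))
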